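{- Let $T$ be a tree. For $i\in\{0,1,2\}$, let $E_i\subseteq E(T)$ be such that every edge of $E_i$ is incident with exactly $i$ vertices whose degree in $T$ is at most $2$. Then for every $k$ with $\frac13\le k\le\frac12$, the graph $T-(E_0\cup E_1\cup E_2)$ has at least $1+k|E_0|+(1-k)|E_1|+|E_2|$ components that contain a vertex whose degree in $T$ is at most $2$.
   Context: $T-E$ denotes the spanning subgraph of $T$ obtained by deleting the edge set $E$ (keeping all vertices).
   Formalization: The parameter k is rational, with $\frac13\le k\le\frac12$. -}

module Defs where

open import Data.Nat as ℕ using (ℕ; zero; suc; _≤_; _≤?_)
open import Data.Fin using (Fin; _<_)
open import Data.Fin.Properties using (_≟_)
open import Data.Product using (Σ; _×_; _,_; proj₁; proj₂)
open import Data.Sum using (_⊎_)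
open import Data.List using (List; []; _∷_; length; filter; _∷ʳ_)
open import Data.List.Membership.Propositional using (_∈_)
open import Data.List.Relation.Unary.All using (All)
open import Data.List.Relation.Unary.Unique.Propositional using (Unique)
open import Data.List.Relation.Unary.Linked using (Linked)
open import Data.List.Relation.Unary.AllPairs using (AllPairs)
open import Relation.Nullary using (¬_; Dec; yes; no)
open import Relation.Nullary.Decidable using (_⊎-dec_)
open import Relation.Binary.PropositionalEquality using (_≡_)
open import Data.Rational as ℚ using (ℚ)
open import Data.Integer using (+_)

-- An edge of a graph on vertex set Fin n, stored in canonical orientation (u , v) with u < v.
Edge : ℕ → Set
Edge n = Fin n × Fin n

record Graph (n : ℕ) : Set where
  field
    edges     : List (Edge n)
    canonical : All (λ e → proj₁ e < proj₂ e) edges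
    unique    : Unique edges
open Graph public

AdjBy : ∀ {n} → (Edge n → Set) → Fin n → Fin n → Set
AdjBy P u v = P (u , v) ⊎ P (v , u)

Adj : ∀ {n} → Graph n → Fin n → Fin n → Set
Adj G = AdjBy (λ e → e ∈ edges G)

data Reach {n : ℕ} (A : Fin n → Fin n → Set) : Fin n → Fin n → Set where
  here : ∀ {u} → Reach A u u
  step : ∀ {u v w} → A u v → Reach A v w → Reach A u w

Connected : ∀ {n} → Graph n → Set
Connected {n} G = (u v : Fin n) → Reach (Adj G) u v

record Cycle {n : ℕ} (G : Graph n) : Set where
  field
    start  : Fin n
    middle : List (Fin n)
    end    : Fin n
    long   : 1 ≤ length middle
    distinct : Unique (start ∷ middle ∷ʳ end)
    path   : Linked (Adj G) (start ∷ middle ∷ʳ end)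
    close  : Adj G end start

Acyclic : ∀ {n} → Graph n → Set
Acyclic G = ¬ Cycle G

record IsTree {n : ℕ} (G : Graph n) : Set where
  field
    nonempty  : ℕ.NonZero n
    connected : Connected G
    acyclic   : Acyclic G

incident? : ∀ {n} (v : Fin n) (e : Edge n) → Dec (v ≡ proj₁ e ⊎ v ≡ proj₂ e)
incident? v e = (v ≟ proj₁ e) ⊎-dec (v ≟ proj₂ e)

deg : ∀ {n} → Graph n → Fin n → ℕ
deg G v = length (filter (incident? v) (edges G))

Low : ∀ {n} → Graph n → Fin n → Set
Low G v = deg G v ≤ 2

lowInd : ∀ {n} → Graph n → Fin n → ℕ
lowInd G v with deg G v ≤? 2
... | yes _ = 1
... | no _  = 0

lowEnds : ∀ {n} → Graph n → Edge n → ℕ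
lowEnds G (u , v) = lowInd G u ℕ.+ lowInd G v

-- An edge subset of G, with cardinality given by the length of a duplicate-free list
record EdgeSubset {n : ℕ} (G : Graph n) : Set where
  field
    list   : List (Edge n)
    nodup  : Unique list
    sub    : All (_∈ edges G) list
open EdgeSubset public

AdjMinus : ∀ {n} (G : Graph n) → (F₀ F₁ F₂ : EdgeSubset G) → Fin n → Fin n → Set
AdjMinus G F₀ F₁ F₂ = AdjBy (λ e → e ∈ edges G × ¬ (e ∈ list F₀) × ¬ (e ∈ list F₁) × ¬ (e ∈ list F₂))

ℕtoℚ : ℕ → ℚ
ℕtoℚ m = + m ℚ./ 1

-- "the graph H has at least x components containing a vertex of degree ≤ 2 in G":
-- there are c ≥ x vertices, each of degree ≤ 2 in G, pairwise in distinct components of H.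
AtLeastLowComponents : ∀ {n} (G : Graph n) (H : Fin n → Fin n → Set) → ℚ → Set
AtLeastLowComponents {n} G H x =
  Σ (List (Fin n)) λ reps →
    All (Low G) reps ×
    AllPairs (λ u v → ¬ Reach H u v) reps ×
    (x ℚ.≤ ℕtoℚ (length reps))

module Submission where

-- Root T at a low vertex r (a deepest vertex for any root is low).  Every edge is
-- a parent edge, so each component of the cut forest has a head, its vertex nearest to r,
-- which is r or the lower end of a removed edge: there are 1 + |E₀| + |E₁| + |E₂| of them.
-- Call a component high if it has no low vertex; let h be their number.  A high component
-- has a high head c with two children, and below each of them the component is left
-- through a removed edge with a high upper end, i.e. an edge of E₀ ∪ E₁; charging these
-- gives 2h ≤ |E₀| + |E₁|.  Adding the parent edge of c (in E₀, or in E₁ with a low upper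
-- end) gives 3h ≤ 2|E₀| + |E₁|, and a convex combination of the two bounds yields
-- h ≤ (1-k)|E₀| + k|E₁|, which is the claim.

-- Rational arithmetic: the final inequality follows from three bounds on natural numbers.
module RationalBounds where

  open import Data.Nat as ℕ using (ℕ; suc)
  import Data.Nat.Properties as ℕ
  open import Data.Integer as ℤ using (+_)
  import Data.Integer.Properties as ℤ
  open import Data.Rational as ℚ using (ℚ; mkℚ; 1ℚ; 0ℚ; _/_; _+_; _*_; _-_; -_)
  import Data.Rational.Properties as ℚ
  import Data.Rational.Unnormalised as ℚᵘ
  import Data.Rational.Unnormalised.Properties as ℚᵘ
  open import Data.Rational.Solver using (module +-*-Solver)
  import Data.Nat.Coprimality as Coprime
  open import Relation.Binary.PropositionalEquality
  open import Defs using (ℕtoℚ)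

  integral : ℕ → ℚ
  integral m = mkℚ (+ m) 0 (Coprime.sym (Coprime.1-coprimeTo m))

  ℕtoℚ-reduced : ∀ m → ℕtoℚ m ≡ integral m
  ℕtoℚ-reduced m = ℚ.normalize-coprime (Coprime.sym (Coprime.1-coprimeTo m))

  ℕtoℚ-mono : ∀ {m n} → m ℕ.≤ n → ℕtoℚ m ℚ.≤ ℕtoℚ n
  ℕtoℚ-mono {m} {n} m≤n rewrite ℕtoℚ-reduced m | ℕtoℚ-reduced n =
    ℚ.*≤* (ℤ.*-monoʳ-≤-nonNeg (+ 1) (ℤ.+≤+ m≤n))

  ℕtoℚ-+ : ∀ m n → ℕtoℚ (m ℕ.+ n) ≡ ℕtoℚ m + ℕtoℚ n
  ℕtoℚ-+ m n rewrite ℕtoℚ-reduced m | ℕtoℚ-reduced n | ℕtoℚ-reduced (m ℕ.+ n) =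
    ℚ.toℚᵘ-injective (ℚᵘ.≃-trans sum≃ (ℚᵘ.≃-sym (ℚ.toℚᵘ-homo-+ (integral m) (integral n))))
    where
    sum≃ : ℚᵘ.mkℚᵘ (+ (m ℕ.+ n)) 0 ℚᵘ.≃ (ℚᵘ.mkℚᵘ (+ m) 0 ℚᵘ.+ ℚᵘ.mkℚᵘ (+ n) 0)
    sum≃ = ℚᵘ.*≡* (cong (ℤ._* + 1) (trans (ℤ.pos-+ m n)
             (sym (cong₂ ℤ._+_ (ℤ.*-identityʳ (+ m)) (ℤ.*-identityʳ (+ n))))))

  -- For 1/3 ≤ k ≤ 1/2 the bound h ≤ (1-k)a + kb is a convex combination of the two
  -- bounds 2h ≤ a + b and 3h ≤ 2a + b, with weights 1-2k ≥ 0 and 3k-1 ≥ 0.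
  convex-bound : ∀ (k h a b : ℚ) → + 1 / 3 ℚ.≤ k → k ℚ.≤ + 1 / 2 →
    h + h ℚ.≤ a + b → h + h + h ℚ.≤ a + a + b → h ℚ.≤ (1ℚ - k) * a + k * b
  convex-bound k h a b k≥⅓ k≤½ two three = begin
    h                                 ≡⟨ solve 2 (λ k h → h := (con 1ℚ :- (k :+ k)) :* (h :+ h :+ h) :+ ((k :+ k :+ k) :- con 1ℚ) :* (h :+ h)) refl k h ⟩
    α * (h + h + h) + β * (h + h)     ≤⟨ ℚ.+-mono-≤ (ℚ.*-monoˡ-≤-nonNeg α {{ℚ.nonNegative 0≤α}} three)
                                                    (ℚ.*-monoˡ-≤-nonNeg β {{ℚ.nonNegative 0≤β}} two) ⟩
    α * (a + a + b) + β * (a + b)     ≡⟨ solve 3 (λ k a b → (con 1ℚ :- (k :+ k)) :* (a :+ a :+ b) :+ ((k :+ k :+ k) :- con 1ℚ) :* (a :+ b) := (con 1ℚ :- k) :* a :+ k :* b) refl k a b ⟩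
    (1ℚ - k) * a + k * b              ∎
    where
    open ℚ.≤-Reasoning
    open +-*-Solver
    α β : ℚ
    α = 1ℚ - (k + k)
    β = (k + k + k) - 1ℚ
    0≤difference : ∀ {p q} → p ℚ.≤ q → 0ℚ ℚ.≤ q - p
    0≤difference {p} p≤q = ℚ.≤-trans (ℚ.≤-reflexive (sym (ℚ.+-inverseʳ p))) (ℚ.+-monoˡ-≤ (- p) p≤q)
    0≤α : 0ℚ ℚ.≤ α
    0≤α = 0≤difference (ℚ.+-mono-≤ k≤½ k≤½)
    0≤β : 0ℚ ℚ.≤ β
    0≤β = 0≤difference (ℚ.+-mono-≤ (ℚ.+-mono-≤ k≥⅓ k≥⅓) k≥⅓)

  counting-to-bound : (e₀ e₁ e₂ h ℓ : ℕ) → (k : ℚ) → + 1 / 3 ℚ.≤ k → k ℚ.≤ + 1 / 2 →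
    suc (e₀ ℕ.+ e₁ ℕ.+ e₂) ℕ.≤ ℓ ℕ.+ h →
    h ℕ.+ h ℕ.≤ e₀ ℕ.+ e₁ → h ℕ.+ h ℕ.+ h ℕ.≤ e₀ ℕ.+ e₀ ℕ.+ e₁ →
    1ℚ + k * ℕtoℚ e₀ + (1ℚ - k) * ℕtoℚ e₁ + ℕtoℚ e₂ ℚ.≤ ℕtoℚ ℓ
  counting-to-bound e₀ e₁ e₂ h ℓ k k≥⅓ k≤½ pieces two three = begin
    target                                      ≡⟨ solve 4 (λ k E₀ E₁ E₂ → con 1ℚ :+ k :* E₀ :+ (con 1ℚ :- k) :* E₁ :+ E₂
                                                        := con 1ℚ :+ (E₀ :+ E₁ :+ E₂) :- ((con 1ℚ :- k) :* E₀ :+ k :* E₁)) refl k E₀ E₁ E₂ ⟩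
    1ℚ + (E₀ + E₁ + E₂) - ((1ℚ - k) * E₀ + k * E₁) ≤⟨ ℚ.+-monoʳ-≤ (1ℚ + (E₀ + E₁ + E₂)) (ℚ.neg-antimono-≤ h≤) ⟩
    1ℚ + (E₀ + E₁ + E₂) - H                     ≤⟨ ℚ.+-monoˡ-≤ (- H) pieces′ ⟩
    L + H - H                                   ≡⟨ solve 2 (λ L H → L :+ H :- H := L) refl L H ⟩
    L                                           ∎
    where
    open ℚ.≤-Reasoning
    open +-*-Solver
    E₀ E₁ E₂ H L target : ℚ
    E₀ = ℕtoℚ e₀
    E₁ = ℕtoℚ e₁
    E₂ = ℕtoℚ e₂
    H = ℕtoℚ h
    L = ℕtoℚ ℓ
    target = 1ℚ + k * E₀ + (1ℚ - k) * E₁ + E₂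
    ℕtoℚ-+₃ : ∀ x y z → ℕtoℚ (x ℕ.+ y ℕ.+ z) ≡ ℕtoℚ x + ℕtoℚ y + ℕtoℚ z
    ℕtoℚ-+₃ x y z = trans (ℕtoℚ-+ (x ℕ.+ y) z) (cong (_+ ℕtoℚ z) (ℕtoℚ-+ x y))
    pieces′ : 1ℚ + (E₀ + E₁ + E₂) ℚ.≤ L + H
    pieces′ = subst₂ ℚ._≤_ (trans (ℕtoℚ-+ 1 (e₀ ℕ.+ e₁ ℕ.+ e₂)) (cong (λ x → 1ℚ + x) (ℕtoℚ-+₃ e₀ e₁ e₂))) (ℕtoℚ-+ ℓ h) (ℕtoℚ-mono pieces)
    h≤ : H ℚ.≤ (1ℚ - k) * E₀ + k * E₁
    h≤ = convex-bound k H E₀ E₁ k≥⅓ k≤½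
           (subst₂ ℚ._≤_ (ℕtoℚ-+ h h) (ℕtoℚ-+ e₀ e₁) (ℕtoℚ-mono two))
           (subst₂ ℚ._≤_ (ℕtoℚ-+₃ h h h) (ℕtoℚ-+₃ e₀ e₀ e₁) (ℕtoℚ-mono three))

module ListCounting where

  open import Level using (0ℓ)
  open import Data.Nat as ℕ using (ℕ; suc; z≤n; s≤s; _≤_; _<_)
  import Data.Nat.Properties as ℕ
  open import Data.Nat.Induction using (<-rec)
  open import Data.Fin using (Fin)
  open import Data.List using (List; []; _∷_; length; filter; map; _++_; _∷ʳ_; allFin)
  import Data.List.Properties as List
  open import Data.List.Membership.Propositional using (_∈_; _∉_)
  open import Data.List.Membership.Propositional.Properties using (∈-∃++; ∈-++⁻; ∈-++⁺ˡ; ∈-++⁺ʳ; ∈-filter⁺; ∈-allFin)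
  open import Data.List.Relation.Unary.All as All using (All; []; _∷_)
  import Data.List.Relation.Unary.All.Properties as All
  open import Data.List.Relation.Unary.Any using (here; there)
  open import Data.List.Relation.Unary.Unique.Propositional using (Unique; []; _∷_)
  import Data.List.Relation.Unary.Unique.Propositional.Properties as Unique
  open import Data.List.Relation.Unary.Linked using (Linked; [-]; _∷_)
  open import Data.List.Extrema.Nat using (argmax; argmax-all; f[xs]≤f[argmax])
  open import Data.Product using (Σ; _×_; _,_)
  open import Data.Sum using (inj₁; inj₂)
  open import Data.Empty using (⊥-elim)
  open import Function using (_∘_)
  open import Relation.Nullary using (¬_; Dec; yes; no; ¬?)
  open import Relation.Unary using (Pred; Decidable)
  open import Relation.Binary.PropositionalEquality

  unique-⊆-length : ∀ {A : Set} {xs ys : List A} → Unique xs → All (_∈ ys) xs → length xs ≤ length ys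
  unique-⊆-length {xs = []} _ _ = z≤n
  unique-⊆-length {xs = x ∷ xs} (x∉xs ∷ xs!) (x∈ys ∷ xs⊆ys) with ∈-∃++ x∈ys
  ... | ys₁ , ys₂ , refl = begin
    suc (length xs)                    ≤⟨ s≤s (unique-⊆-length xs! (All.zipWith delete (x∉xs , xs⊆ys))) ⟩
    suc (length (ys₁ ++ ys₂))          ≡⟨ cong suc (List.length-++ ys₁) ⟩
    suc (length ys₁ ℕ.+ length ys₂)    ≡⟨ ℕ.+-suc (length ys₁) (length ys₂) ⟨
    length ys₁ ℕ.+ length (x ∷ ys₂)    ≡⟨ List.length-++ ys₁ ⟨
    length (ys₁ ++ x ∷ ys₂)            ∎
    where
    open ℕ.≤-Reasoning
    delete : ∀ {z} → ¬ x ≡ z × z ∈ ys₁ ++ x ∷ ys₂ → z ∈ ys₁ ++ ys₂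
    delete (x≢z , z∈) with ∈-++⁻ ys₁ z∈
    ... | inj₁ z∈ys₁         = ∈-++⁺ˡ z∈ys₁
    ... | inj₂ (here refl)   = ⊥-elim (x≢z refl)
    ... | inj₂ (there z∈ys₂) = ∈-++⁺ʳ ys₁ z∈ys₂

  map-unique-on : ∀ {A B : Set} (f : A → B) {xs : List A} → Unique xs →
    (∀ {a b} → a ∈ xs → b ∈ xs → f a ≡ f b → a ≡ b) → Unique (map f xs)
  map-unique-on f {[]} [] _ = []
  map-unique-on f {x ∷ xs} (x∉xs ∷ xs!) injective =
    distinct xs x∉xs (injective (here refl) ∘ there) ∷ map-unique-on f xs! (λ a b → injective (there a) (there b))
    where
    distinct : ∀ zs → All (λ z → ¬ x ≡ z) zs → (∀ {z} → z ∈ zs → f x ≡ f z → x ≡ z) → All (λ w → ¬ f x ≡ w) (map f zs)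
    distinct []       []         _   = []
    distinct (z ∷ zs) (x≢z ∷ ne) inj = (x≢z ∘ inj (here refl)) ∷ distinct zs ne (inj ∘ there)

  filter-complement-length : ∀ {A : Set} {P : Pred A 0ℓ} (P? : Decidable P) (xs : List A) →
    length (filter P? xs) ℕ.+ length (filter (¬? ∘ P?) xs) ≡ length xs
  filter-complement-length P? [] = refl
  filter-complement-length P? (x ∷ xs) with P? x
  ... | yes _ = cong suc (filter-complement-length P? xs)
  ... | no _  = trans (ℕ.+-suc _ _) (cong suc (filter-complement-length P? xs))

  unique-constant-length : ∀ {A : Set} {e : A} {xs : List A} → Unique xs → All (_≡ e) xs → length xs ≤ 1
  unique-constant-length {xs = []}         _ _ = z≤n
  unique-constant-length {xs = x ∷ []}     _ _ = s≤s z≤n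
  unique-constant-length {xs = x ∷ y ∷ xs} ((x≢y ∷ _) ∷ _) (refl ∷ refl ∷ _) = ⊥-elim (x≢y refl)

  unique-∷ʳ : ∀ {A : Set} {xs : List A} {y : A} → Unique xs → y ∉ xs → Unique (xs ∷ʳ y)
  unique-∷ʳ xs! y∉xs = Unique.++⁺ xs! ([] ∷ []) λ { (y∈xs , here refl) → y∉xs y∈xs }

  linked-∷ʳ : ∀ {A : Set} {R : A → A → Set} (xs : List A) {y z : A} →
    Linked R (xs ∷ʳ y) → R y z → Linked R (xs ∷ʳ y ∷ʳ z)
  linked-∷ʳ []           _            Ryz = Ryz ∷ [-]
  linked-∷ʳ (x ∷ [])     (Rxy ∷ rest) Ryz = Rxy ∷ linked-∷ʳ [] rest Ryz
  linked-∷ʳ (x ∷ w ∷ xs) (Rxw ∷ rest) Ryz = Rxw ∷ linked-∷ʳ (w ∷ xs) rest Ryz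

  -- Charging argument: if every member of a duplicate-free list of owners owns k distinct
  -- elements of a pool (each element having a single owner), then k times the number of
  -- owners is at most the size of the pool.
  module Charging {A B : Set} (owner : B → A) (pool : List B) (k : ℕ) where

    record Share (c : A) : Set where
      field
        items  : List B
        items! : Unique items
        owned  : All (λ b → owner b ≡ c) items
        inPool : All (_∈ pool) items
        enough : k ≤ length items

    collect : (cs : List A) → All Share cs → List B
    collect []       []             = []
    collect (c ∷ cs) (share ∷ rest) = Share.items share ++ collect cs rest

    collect-owners : ∀ cs shares → All (λ b → owner b ∈ cs) (collect cs shares)
    collect-owners []       []             = []
    collect-owners (c ∷ cs) (share ∷ rest) =
      All.++⁺ (All.map here (Share.owned share)) (All.map there (collect-owners cs rest))

    -- shares of distinct owners are disjoint, since every item has only one owner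
    collect-unique : ∀ cs shares → Unique cs → Unique (collect cs shares)
    collect-unique []       []             _           = []
    collect-unique (c ∷ cs) (share ∷ rest) (c∉cs ∷ cs!) =
      Unique.++⁺ (Share.items! share) (collect-unique cs rest cs!) disjoint
      where
      disjoint : ∀ {b} → ¬ (b ∈ Share.items share × b ∈ collect cs rest)
      disjoint (b∈share , b∈rest) =
        All.lookup c∉cs (subst (_∈ cs) (All.lookup (Share.owned share) b∈share)
                                       (All.lookup (collect-owners cs rest) b∈rest)) refl

    collect-length : ∀ cs shares → k ℕ.* length cs ≤ length (collect cs shares)
    collect-length []       []             = ℕ.≤-reflexive (ℕ.*-zeroʳ k)
    collect-length (c ∷ cs) (share ∷ rest) = begin
      k ℕ.* suc (length cs)                                 ≡⟨ ℕ.*-suc k (length cs) ⟩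
      k ℕ.+ k ℕ.* length cs                                 ≤⟨ ℕ.+-mono-≤ (Share.enough share) (collect-length cs rest) ⟩
      length (Share.items share) ℕ.+ length (collect cs rest) ≡⟨ List.length-++ (Share.items share) ⟨
      length (collect (c ∷ cs) (share ∷ rest))              ∎
      where open ℕ.≤-Reasoning

    charging-bound : ∀ cs → All Share cs → Unique cs → k ℕ.* length cs ≤ length pool
    charging-bound cs shares cs! = ℕ.≤-trans (collect-length cs shares)
      (unique-⊆-length (collect-unique cs shares cs!) (collect-pool cs shares))
      where
      collect-pool : ∀ cs shares → All (_∈ pool) (collect cs shares)
      collect-pool []       []             = []
      collect-pool (c ∷ cs) (share ∷ rest) = All.++⁺ (Share.inPool share) (collect-pool cs rest)

  LeastWitness : (ℕ → Set) → Set
  LeastWitness P = Σ ℕ λ k → P k × (∀ j → j < k → ¬ P j)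

  least-witness : {P : ℕ → Set} → (∀ k → Dec (P k)) → ∀ {K} → P K → LeastWitness P
  least-witness {P} P? {K} = <-rec (λ K → P K → LeastWitness P) step K
    where
    step : ∀ K → (∀ {j} → j < K → P j → LeastWitness P) → P K → LeastWitness P
    step K smaller pK with ℕ.anyUpTo? P? K
    ... | yes (j , j<K , pj) = smaller j<K pj
    ... | no none            = K , pK , λ j j<K pj → none (j , j<K , pj)

  maximiser : ∀ {n} {P : Pred (Fin n) 0ℓ} → Decidable P → (f : Fin n → ℕ) → ∀ {v₀} → P v₀ →
    Σ (Fin n) λ v → P v × (∀ w → P w → f w ≤ f v)
  maximiser {n} P? f {v₀} pv₀ =
    best , argmax-all f pv₀ (All.all-filter P? (allFin n)) ,
    λ w pw → All.lookup (f[xs]≤f[argmax] v₀ candidates) (∈-filter⁺ P? (∈-allFin w) pw)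
    where
    candidates : List (Fin n)
    candidates = filter P? (allFin n)
    best : Fin n
    best = argmax f v₀ candidates

module RootedTrees where

  open import Defs
  open ListCounting
  open import Data.Nat as ℕ using (ℕ; zero; suc; z≤n; s≤s; _+_; _≤_; _<_; _∸_)
  import Data.Nat.Properties as ℕ
  open import Data.Fin as Fin using (Fin)
  open import Data.Fin.Properties using (_≟_; _<?_; any?; <-irrefl; <-asym)
  open import Data.List using (List; []; _∷_; length; filter; _∷ʳ_)
  import Data.List.Properties as List
  open import Data.List.Membership.Propositional using (_∈_; _∉_)
  open import Data.List.Membership.Propositional.Properties using (∈-filter⁻)
  import Data.List.Membership.DecPropositional as DecMembership
  open import Data.List.Relation.Unary.All as All using (All; []; _∷_)
  import Data.List.Relation.Unary.All.Properties as All
  open import Data.List.Relation.Unary.Unique.Propositional using (Unique; []; _∷_)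
  import Data.List.Relation.Unary.Unique.Propositional.Properties as Unique
  open import Data.List.Relation.Unary.Linked using (Linked; [-]; _∷_)
  open import Data.Product using (Σ; _×_; _,_; proj₁; proj₂)
  open import Data.Product.Properties using (≡-dec)
  open import Data.Sum as Sum using (_⊎_; inj₁; inj₂)
  open import Data.Empty using (⊥; ⊥-elim)
  open import Relation.Nullary using (¬_; Dec; yes; no)
  open import Relation.Nullary.Decidable using (_⊎-dec_; _×-dec_)
  open import Relation.Binary.Definitions using (DecidableEquality)
  open import Relation.Binary.PropositionalEquality
  open import Function using (_∘_; _∘′_)
  open import Data.Unit using (⊤; tt)

  module GraphFacts {n : ℕ} (G : Graph n) where

    _≟ᵉ_ : DecidableEquality (Edge n)
    _≟ᵉ_ = ≡-dec _≟_ _≟_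

    open DecMembership _≟ᵉ_ public using (_∈?_)

    adjacent? : ∀ u v → Dec (Adj G u v)
    adjacent? u v = ((u , v) ∈? edges G) ⊎-dec ((v , u) ∈? edges G)

    adj-sym : ∀ {u v} → Adj G u v → Adj G v u
    adj-sym = Sum.swap

    adj-irreflexive : ∀ {u v} → Adj G u v → ¬ u ≡ v
    adj-irreflexive (inj₁ uv∈G) refl = <-irrefl refl (All.lookup (canonical G) uv∈G)
    adj-irreflexive (inj₂ vu∈G) refl = <-irrefl refl (All.lookup (canonical G) vu∈G)

    edgeBetween : Fin n → Fin n → Edge n
    edgeBetween x y with x <? y
    ... | yes _ = (x , y)
    ... | no _  = (y , x)

    edgeBetween-cases : ∀ x y → edgeBetween x y ≡ (x , y) ⊎ edgeBetween x y ≡ (y , x)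
    edgeBetween-cases x y with x <? y
    ... | yes _ = inj₁ refl
    ... | no _  = inj₂ refl

    edge-is-edgeBetween : ∀ {e x y} → e ∈ edges G → e ≡ (x , y) ⊎ e ≡ (y , x) → e ≡ edgeBetween x y
    edge-is-edgeBetween {x = x} {y} xy∈G (inj₁ refl) with x <? y
    ... | yes _   = refl
    ... | no x≮y  = ⊥-elim (x≮y (All.lookup (canonical G) xy∈G))
    edge-is-edgeBetween {x = x} {y} yx∈G (inj₂ refl) with x <? y
    ... | yes x<y = ⊥-elim (<-asym x<y (All.lookup (canonical G) yx∈G))
    ... | no _    = refl

    edgeBetween-∈ : ∀ {x y} → Adj G x y → edgeBetween x y ∈ edges G
    edgeBetween-∈ (inj₁ xy∈G) = subst (_∈ edges G) (edge-is-edgeBetween xy∈G (inj₁ refl)) xy∈G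
    edgeBetween-∈ (inj₂ yx∈G) = subst (_∈ edges G) (edge-is-edgeBetween yx∈G (inj₂ refl)) yx∈G

    edgeBetween-sym : ∀ {x y} → Adj G x y → edgeBetween x y ≡ edgeBetween y x
    edgeBetween-sym {x} {y} xy = edge-is-edgeBetween (edgeBetween-∈ xy) (Sum.swap (edgeBetween-cases x y))

    lowInd-high : ∀ {v} → ¬ Low G v → lowInd G v ≡ 0
    lowInd-high {v} high with deg G v ℕ.≤? 2
    ... | yes low = ⊥-elim (high low)
    ... | no _    = refl

    lowInd-one : ∀ {v} → lowInd G v ≡ 1 → Low G v
    lowInd-one {v} ind≡1 with deg G v ℕ.≤? 2
    ... | yes low = low

    lowInd-≤1 : ∀ v → lowInd G v ≤ 1
    lowInd-≤1 v with deg G v ℕ.≤? 2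
    ... | yes _ = s≤s z≤n
    ... | no _  = z≤n

    lowEnds-edgeBetween : ∀ a b → lowEnds G (edgeBetween a b) ≡ lowInd G a + lowInd G b
    lowEnds-edgeBetween a b with edgeBetween-cases a b
    ... | inj₁ eq rewrite eq = refl
    ... | inj₂ eq rewrite eq = ℕ.+-comm (lowInd G b) (lowInd G a)

  -- A tree rooted at r: every vertex gets a depth (distance to r) and a parent (the next
  -- vertex on a shortest walk to r).  Acyclicity makes every edge a parent–child edge.
  module Rooted {n : ℕ} (T : Graph n) (isTree : IsTree T) (r : Fin n) where

    open GraphFacts T

    WithinDist : ℕ → Fin n → Set
    WithinDist zero    u = u ≡ r
    WithinDist (suc k) u = u ≡ r ⊎ Σ (Fin n) λ w → Adj T u w × WithinDist k w

    withinDist? : ∀ k u → Dec (WithinDist k u)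
    withinDist? zero    u = u ≟ r
    withinDist? (suc k) u = (u ≟ r) ⊎-dec any? (λ w → adjacent? u w ×-dec withinDist? k w)

    walk⇒withinDist : ∀ {u v} → Reach (Adj T) u v → v ≡ r → Σ ℕ λ k → WithinDist k u
    walk⇒withinDist here           v≡r = zero , v≡r
    walk⇒withinDist (step uw rest) v≡r with walk⇒withinDist rest v≡r
    ... | k , within = suc k , inj₂ (_ , uw , within)

    firstStep : ∀ u k → WithinDist k u → Fin n
    firstStep u zero    _                 = u
    firstStep u (suc k) (inj₁ _)          = u
    firstStep u (suc k) (inj₂ (w , _ , _)) = w

    -- depth and parent are used only through the specifications proved in this block
    opaque
      shortest : ∀ u → LeastWitness (λ k → WithinDist k u)
      shortest u = least-witness (λ k → withinDist? k u)
                     (proj₂ (walk⇒withinDist (IsTree.connected isTree u r) refl))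

      depth : Fin n → ℕ
      depth u = proj₁ (shortest u)

      depth-within : ∀ u → WithinDist (depth u) u
      depth-within u = proj₁ (proj₂ (shortest u))

      depth-minimal : ∀ {j u} → WithinDist j u → depth u ≤ j
      depth-minimal {j} {u} within = ℕ.≮⇒≥ λ j<depth → proj₂ (proj₂ (shortest u)) j j<depth within

      parent : Fin n → Fin n
      parent u = firstStep u (depth u) (depth-within u)

      firstStep-spec : ∀ u k (within : WithinDist k u) → (∀ j → j < k → ¬ WithinDist j u) →
        (u ≡ r × firstStep u k within ≡ u) ⊎
        (¬ u ≡ r × Adj T u (firstStep u k within) × k ≡ suc (depth (firstStep u k within)))
      firstStep-spec u zero    u≡r              _       = inj₁ (u≡r , refl)
      firstStep-spec u (suc k) (inj₁ u≡r)       _       = inj₁ (u≡r , refl)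
      firstStep-spec u (suc k) (inj₂ (w , uw , w-within)) shorter =
        inj₂ ((λ u≡r → shorter 0 (s≤s z≤n) u≡r) , uw , cong suc (ℕ.≤-antisym k≤depth-w (depth-minimal w-within)))
        where
        k≤depth-w : k ≤ depth w
        k≤depth-w = ℕ.≮⇒≥ λ depth-w<k → shorter (suc (depth w)) (s≤s depth-w<k) (inj₂ (w , uw , depth-within w))

      parent-spec : ∀ u → (u ≡ r × parent u ≡ u) ⊎ (¬ u ≡ r × Adj T u (parent u) × depth u ≡ suc (depth (parent u)))
      parent-spec u = firstStep-spec u (depth u) (depth-within u) (proj₂ (proj₂ (shortest u)))

    parent-root : parent r ≡ r
    parent-root with parent-spec r
    ... | inj₁ (_ , p≡r)   = p≡r
    ... | inj₂ (r≢r , _)   = ⊥-elim (r≢r refl)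

    parent-adj : ∀ {u} → ¬ u ≡ r → Adj T u (parent u)
    parent-adj u≢r with parent-spec _
    ... | inj₁ (u≡r , _)     = ⊥-elim (u≢r u≡r)
    ... | inj₂ (_ , adj , _) = adj

    depth-parent : ∀ {u} → ¬ u ≡ r → depth u ≡ suc (depth (parent u))
    depth-parent u≢r with parent-spec _
    ... | inj₁ (u≡r , _)   = ⊥-elim (u≢r u≡r)
    ... | inj₂ (_ , _ , eq) = eq

    parent-shallower : ∀ {u} → ¬ u ≡ r → depth (parent u) < depth u
    parent-shallower u≢r = ℕ.≤-reflexive (sym (depth-parent u≢r))

    depth-root : depth r ≡ 0
    depth-root = ℕ.n≤0⇒n≡0 (depth-minimal {0} refl)

    depth-zero : ∀ {u} → depth u ≡ 0 → u ≡ r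
    depth-zero {u} depth≡0 with depth u | depth-within u
    ... | zero | u≡r = u≡r

    depth-parent-∸ : ∀ u → depth (parent u) ≡ depth u ∸ 1
    depth-parent-∸ u with u ≟ r
    ... | yes u≡r  = subst (λ x → depth (parent x) ≡ depth x ∸ 1) (sym u≡r)
                       (trans (cong depth parent-root) (trans depth-root (cong (_∸ 1) (sym depth-root))))
    ... | no u≢r   = cong (_∸ 1) (sym (depth-parent u≢r))

    Child : Fin n → Fin n → Set
    Child x v = ¬ x ≡ r × parent x ≡ v

    depth-child : ∀ {x v} → Child x v → depth x ≡ suc (depth v)
    depth-child (x≢r , px≡v) = trans (depth-parent x≢r) (cong (suc ∘′ depth) px≡v)

    -- climb k v is the k-th ancestor of v (the root is its own parent)
    climb : ℕ → Fin n → Fin n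
    climb zero    v = v
    climb (suc k) v = climb k (parent v)

    depth-climb : ∀ k v → depth (climb k v) ≡ depth v ∸ k
    depth-climb zero    v = refl
    depth-climb (suc k) v = begin
      depth (climb k (parent v)) ≡⟨ depth-climb k (parent v) ⟩
      depth (parent v) ∸ k       ≡⟨ cong (_∸ k) (depth-parent-∸ v) ⟩
      depth v ∸ 1 ∸ k            ≡⟨ ℕ.∸-+-assoc (depth v) 1 k ⟩
      depth v ∸ suc k            ∎
      where open ≡-Reasoning

    climb-root : ∀ k → climb k r ≡ r
    climb-root zero    = refl
    climb-root (suc k) = trans (cong (climb k) parent-root) (climb-root k)

    Ancestor : Fin n → Fin n → Set
    Ancestor a v = Σ ℕ λ k → climb k v ≡ a

    ancestor-refl : ∀ {v} → Ancestor v v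
    ancestor-refl = 0 , refl

    ancestor-of-parent : ∀ {a v} → Ancestor a (parent v) → Ancestor a v
    ancestor-of-parent (k , eq) = suc k , eq

    ancestor-shallower : ∀ {a v} → Ancestor a v → depth a ≤ depth v
    ancestor-shallower {v = v} (k , refl) = subst (_≤ depth v) (sym (depth-climb k v)) (ℕ.m∸n≤m (depth v) k)

    ancestor-same-depth : ∀ {a v} → Ancestor a v → depth a ≡ depth v → a ≡ v
    ancestor-same-depth (zero , refl) _ = refl
    ancestor-same-depth {v = v} (suc k , refl) same with v ≟ r
    ... | yes v≡r = subst (λ x → climb k (parent x) ≡ x) (sym v≡r) (climb-root (suc k))
    ... | no v≢r  = ⊥-elim (ℕ.<-irrefl same (ℕ.≤-<-trans (ancestor-shallower (k , refl)) (parent-shallower v≢r)))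

    record AncestralPath (a b : Fin n) : Set where
      field
        inner     : List (Fin n)
        distinct  : Unique (a ∷ inner ∷ʳ b)
        linked    : Linked (Adj T) (a ∷ inner ∷ʳ b)
        ancestral : All (λ v → Ancestor v a ⊎ Ancestor v b) (a ∷ inner ∷ʳ b)
        long      : 1 ≤ length inner ⊎ (parent a ≡ b ⊎ parent b ≡ a)

    deeper-not-root : ∀ {a b} → depth b ≤ depth a → ¬ a ≡ b → ¬ a ≡ r
    deeper-not-root {a} {b} b≤a a≢b a≡r = a≢b (trans a≡r (sym (depth-zero (ℕ.n≤0⇒n≡0 b≤0))))
      where
      b≤0 : depth b ≤ 0
      b≤0 = subst (depth b ≤_) (trans (cong depth a≡r) depth-root) b≤a

    PathsAt : ℕ → Set
    PathsAt N = ∀ a b → depth a + depth b ≡ N → ¬ a ≡ b → AncestralPath a b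

    climb-left : ∀ {N} → PathsAt N → ∀ {a b} → depth a + depth b ≡ suc N →
      depth b ≤ depth a → ¬ a ≡ b → AncestralPath a b
    climb-left {N} paths {a} {b} total b≤a a≢b with parent a ≟ b
    ... | yes pa≡b = record
      { inner = [] ; distinct = (a≢b ∷ []) ∷ [] ∷ []
      ; linked = subst (Adj T a) pa≡b (parent-adj a≢r) ∷ [-]
      ; ancestral = inj₁ ancestor-refl ∷ inj₁ (1 , pa≡b) ∷ []
      ; long = inj₂ (inj₁ pa≡b) }
      where
      a≢r : ¬ a ≡ r
      a≢r = deeper-not-root b≤a a≢b
    ... | no pa≢b = record
      { inner = parent a ∷ AncestralPath.inner rest
      ; distinct = All.map a-fresh (AncestralPath.ancestral rest) ∷ AncestralPath.distinct rest
      ; linked = parent-adj a≢r ∷ AncestralPath.linked rest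
      ; ancestral = inj₁ ancestor-refl ∷ All.map (Sum.map₁ ancestor-of-parent) (AncestralPath.ancestral rest)
      ; long = inj₁ (s≤s z≤n) }
      where
      a≢r : ¬ a ≡ r
      a≢r = deeper-not-root b≤a a≢b
      rest : AncestralPath (parent a) b
      rest = paths (parent a) b (ℕ.suc-injective (trans (cong (_+ depth b) (sym (depth-parent a≢r))) total)) pa≢b
      a-fresh : ∀ {v} → Ancestor v (parent a) ⊎ Ancestor v b → ¬ a ≡ v
      a-fresh (inj₁ anc) refl = ℕ.<-irrefl refl (ℕ.≤-<-trans (ancestor-shallower anc) (parent-shallower a≢r))
      a-fresh (inj₂ anc) refl = a≢b (ancestor-same-depth anc (ℕ.≤-antisym (ancestor-shallower anc) b≤a))

    climb-right : ∀ {N} → PathsAt N → ∀ {a b} → depth a + depth b ≡ suc N →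
      depth a < depth b → ¬ a ≡ b → AncestralPath a b
    climb-right {N} paths {a} {b} total a<b a≢b with a ≟ parent b
    ... | yes a≡pb = record
      { inner = [] ; distinct = (a≢b ∷ []) ∷ [] ∷ []
      ; linked = subst (λ x → Adj T x b) (sym a≡pb) (adj-sym (parent-adj b≢r)) ∷ [-]
      ; ancestral = inj₁ ancestor-refl ∷ inj₂ ancestor-refl ∷ []
      ; long = inj₂ (inj₂ (sym a≡pb)) }
      where
      b≢r : ¬ b ≡ r
      b≢r = deeper-not-root (ℕ.<⇒≤ a<b) (a≢b ∘ sym)
    ... | no a≢pb = record
      { inner = AncestralPath.inner rest ∷ʳ parent b
      ; distinct = unique-∷ʳ (AncestralPath.distinct rest) b-fresh
      ; linked = linked-∷ʳ (a ∷ AncestralPath.inner rest) (AncestralPath.linked rest) (adj-sym (parent-adj b≢r))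
      ; ancestral = All.∷ʳ⁺ (All.map (Sum.map₂ ancestor-of-parent) (AncestralPath.ancestral rest)) (inj₂ ancestor-refl)
      ; long = inj₁ (subst (1 ≤_) (sym (List.length-++ (AncestralPath.inner rest)))
                           (ℕ.m≤n+m 1 (length (AncestralPath.inner rest)))) }
      where
      b≢r : ¬ b ≡ r
      b≢r = deeper-not-root (ℕ.<⇒≤ a<b) (a≢b ∘ sym)
      rest : AncestralPath a (parent b)
      rest = paths a (parent b)
        (ℕ.suc-injective (trans (sym (ℕ.+-suc (depth a) _)) (trans (cong (depth a +_) (sym (depth-parent b≢r))) total)))
        a≢pb

      b-fresh : b ∉ a ∷ AncestralPath.inner rest ∷ʳ parent b
      b-fresh b∈ with All.lookup (AncestralPath.ancestral rest) b∈
      ... | inj₁ anc = ℕ.<⇒≱ a<b (ancestor-shallower anc)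
      ... | inj₂ anc = ℕ.<⇒≱ (parent-shallower b≢r) (ancestor-shallower anc)

    ancestral-path : ∀ N → PathsAt N
    ancestral-path zero    a b total a≢b =
      ⊥-elim (a≢b (trans (depth-zero (ℕ.m+n≡0⇒m≡0 (depth a) total)) (sym (depth-zero (ℕ.m+n≡0⇒n≡0 (depth a) total)))))
    ancestral-path (suc N) a b total a≢b with depth b ℕ.≤? depth a
    ... | yes b≤a = climb-left  (ancestral-path N) total b≤a a≢b
    ... | no  b≰a = climb-right (ancestral-path N) total (ℕ.≰⇒> b≰a) a≢b

    neighbour-child : ∀ {u v} → Adj T u v → parent u ≡ v → Child u v
    neighbour-child uv pu≡v = u≢r , pu≡v
      where
      u≢r : ¬ _ ≡ r
      u≢r u≡r = adj-irreflexive uv (trans u≡r (sym (trans (sym pu≡v) (trans (cong parent u≡r) parent-root))))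

    -- Of two adjacent vertices one is the parent of the other: otherwise the ancestral path
    -- between them has an inner vertex and, closed up by their edge, is a cycle in T.
    adjacent⇒parent-child : ∀ {u v} → Adj T u v → Child u v ⊎ Child v u
    adjacent⇒parent-child {u} {v} uv with parent u ≟ v | parent v ≟ u
    ... | yes pu≡v | _        = inj₁ (neighbour-child uv pu≡v)
    ... | no _     | yes pv≡u = inj₂ (neighbour-child (adj-sym uv) pv≡u)
    ... | no pu≢v  | no pv≢u  = ⊥-elim (IsTree.acyclic isTree cycle)
      where
      path : AncestralPath u v
      path = ancestral-path _ u v refl (adj-irreflexive uv)
      has-inner : 1 ≤ length (AncestralPath.inner path)
      has-inner with AncestralPath.long path
      ... | inj₁ long         = long
      ... | inj₂ (inj₁ pu≡v) = ⊥-elim (pu≢v pu≡v)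
      ... | inj₂ (inj₂ pv≡u) = ⊥-elim (pv≢u pv≡u)
      cycle : Cycle T
      cycle = record
        { start = u ; middle = AncestralPath.inner path ; end = v ; long = has-inner
        ; distinct = AncestralPath.distinct path ; path = AncestralPath.linked path ; close = adj-sym uv }

    parentEdge : Fin n → Edge n
    parentEdge v = edgeBetween v (parent v)

    parentEdge-∈ : ∀ {v} → ¬ v ≡ r → parentEdge v ∈ edges T
    parentEdge-∈ v≢r = edgeBetween-∈ (parent-adj v≢r)

    no-two-cycle : ∀ {v w} → ¬ v ≡ r → ¬ w ≡ r → v ≡ parent w → parent v ≡ w → ⊥
    no-two-cycle {v} {w} v≢r w≢r v≡pw pv≡w = ℕ.<-irrefl refl (begin-strict
      depth v            ≡⟨ cong depth v≡pw ⟩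
      depth (parent w)   <⟨ parent-shallower w≢r ⟩
      depth w            ≡⟨ cong depth pv≡w ⟨
      depth (parent v)   <⟨ parent-shallower v≢r ⟩
      depth v            ∎)
      where open ℕ.≤-Reasoning

    parentEdge-injective : ∀ {v w} → ¬ v ≡ r → ¬ w ≡ r → parentEdge v ≡ parentEdge w → v ≡ w
    parentEdge-injective {v} {w} v≢r w≢r same
      with edgeBetween-cases v (parent v) | edgeBetween-cases w (parent w)
    ... | inj₁ ev | inj₁ ew = cong proj₁ (trans (sym ev) (trans same ew))
    ... | inj₂ ev | inj₂ ew = cong proj₂ (trans (sym ev) (trans same ew))
    ... | inj₁ ev | inj₂ ew = ⊥-elim (no-two-cycle v≢r w≢r (cong proj₁ (trans (sym ev) (trans same ew)))
                                                            (cong proj₂ (trans (sym ev) (trans same ew))))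
    ... | inj₂ ev | inj₁ ew = ⊥-elim (no-two-cycle w≢r v≢r (cong proj₁ (trans (sym ew) (trans (sym same) ev)))
                                                            (cong proj₂ (trans (sym ew) (trans (sym same) ev))))

    -- the endpoint of an edge that is farther from r; the edge is its parent edge
    lowerEnd : Edge n → Fin n
    lowerEnd (a , b) with parent a ≟ b
    ... | yes _ = a
    ... | no _  = b

    lowerEnd-spec : ∀ {e} → e ∈ edges T → ¬ lowerEnd e ≡ r × parentEdge (lowerEnd e) ≡ e
    lowerEnd-spec {a , b} ab∈T with parent a ≟ b | adjacent⇒parent-child (inj₁ ab∈T)
    ... | yes pa≡b | _                  =
      proj₁ (neighbour-child (inj₁ ab∈T) pa≡b) ,
      trans (cong (edgeBetween a) pa≡b) (sym (edge-is-edgeBetween ab∈T (inj₁ refl)))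
    ... | no pa≢b  | inj₁ (_ , pa≡b)   = ⊥-elim (pa≢b pa≡b)
    ... | no _     | inj₂ (b≢r , pb≡a) =
      b≢r , trans (cong (edgeBetween b) pb≡a) (sym (edge-is-edgeBetween ab∈T (inj₂ refl)))

    lowerEnd-parentEdge : ∀ {v} → ¬ v ≡ r → lowerEnd (parentEdge v) ≡ v
    lowerEnd-parentEdge {v} v≢r = parentEdge-injective (proj₁ spec) v≢r (proj₂ spec)
      where
      spec : ¬ lowerEnd (parentEdge v) ≡ r × parentEdge (lowerEnd (parentEdge v)) ≡ parentEdge v
      spec = lowerEnd-spec (parentEdge-∈ v≢r)

    lowerEnd-injective : ∀ {e e′} → e ∈ edges T → e′ ∈ edges T → lowerEnd e ≡ lowerEnd e′ → e ≡ e′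
    lowerEnd-injective e∈T e′∈T same =
      trans (sym (proj₂ (lowerEnd-spec e∈T))) (trans (cong parentEdge same) (proj₂ (lowerEnd-spec e′∈T)))

    incidentEdges : Fin n → List (Edge n)
    incidentEdges v = filter (incident? v) (edges T)

    incidentEdges-unique : ∀ v → Unique (incidentEdges v)
    incidentEdges-unique v = Unique.filter⁺ (incident? v) (unique T)

    IncidentAt : Fin n → Edge n → Set
    IncidentAt v e = e ≡ parentEdge v ⊎ Σ (Fin n) λ x → Child x v × e ≡ parentEdge x

    incident-classified : ∀ v → All (IncidentAt v) (incidentEdges v)
    incident-classified v = All.tabulate classify
      where
      other-end : ∀ {e} → e ∈ edges T → v ≡ proj₁ e ⊎ v ≡ proj₂ e → Σ (Fin n) λ o → Adj T v o × e ≡ edgeBetween v o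
      other-end {x , y} xy∈T (inj₁ refl) = y , inj₁ xy∈T , edge-is-edgeBetween xy∈T (inj₁ refl)
      other-end {x , y} xy∈T (inj₂ refl) = x , inj₂ xy∈T , edge-is-edgeBetween xy∈T (inj₂ refl)
      classify : ∀ {e} → e ∈ incidentEdges v → IncidentAt v e
      classify e∈ with ∈-filter⁻ (incident? v) {xs = edges T} e∈
      ... | e∈T , at-v with other-end e∈T at-v
      ...   | o , vo , e≡ with adjacent⇒parent-child vo
      ...     | inj₁ (_ , pv≡o)       = inj₁ (trans e≡ (cong (edgeBetween v) (sym pv≡o)))
      ...     | inj₂ o-child@(_ , po≡v) =
        inj₂ (o , o-child , trans e≡ (trans (edgeBetween-sym vo) (cong (edgeBetween o) (sym po≡v))))

    TwoChildren : Fin n → Set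
    TwoChildren v = Σ (Fin n) λ x → Σ (Fin n) λ y → Child x v × Child y v × ¬ x ≡ y

    -- among three distinct edges at v at most one is v's parent edge, so two lead to children
    three-edges⇒two-children : ∀ {v} (es : List (Edge n)) → Unique es → All (IncidentAt v) es →
      2 < length es → TwoChildren v
    three-edges⇒two-children (_ ∷ [])      _ _ (s≤s ())
    three-edges⇒two-children (_ ∷ _ ∷ [])  _ _ (s≤s (s≤s ()))
    three-edges⇒two-children (e₁ ∷ e₂ ∷ e₃ ∷ _) ((e₁≢e₂ ∷ e₁≢e₃ ∷ _) ∷ (e₂≢e₃ ∷ _) ∷ _) (c₁ ∷ c₂ ∷ c₃ ∷ _) _ =
      choose c₁ c₂ c₃
      where
      distinct-children : ∀ {e e′ x x′} → ¬ e ≡ e′ → e ≡ parentEdge x → e′ ≡ parentEdge x′ → ¬ x ≡ x′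
      distinct-children e≢e′ e≡ e′≡ refl = e≢e′ (trans e≡ (sym e′≡))
      choose : IncidentAt _ e₁ → IncidentAt _ e₂ → IncidentAt _ e₃ → TwoChildren _
      choose (inj₁ p₁) (inj₁ p₂) _ = ⊥-elim (e₁≢e₂ (trans p₁ (sym p₂)))
      choose (inj₁ p₁) (inj₂ _) (inj₁ p₃) = ⊥-elim (e₁≢e₃ (trans p₁ (sym p₃)))
      choose _ (inj₁ p₂) (inj₁ p₃) = ⊥-elim (e₂≢e₃ (trans p₂ (sym p₃)))
      choose (inj₁ _) (inj₂ (x₂ , ch₂ , q₂)) (inj₂ (x₃ , ch₃ , q₃)) = x₂ , x₃ , ch₂ , ch₃ , distinct-children e₂≢e₃ q₂ q₃
      choose (inj₂ (x₁ , ch₁ , q₁)) (inj₁ _) (inj₂ (x₃ , ch₃ , q₃)) = x₁ , x₃ , ch₁ , ch₃ , distinct-children e₁≢e₃ q₁ q₃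
      choose (inj₂ (x₁ , ch₁ , q₁)) (inj₂ (x₂ , ch₂ , q₂)) _ = x₁ , x₂ , ch₁ , ch₂ , distinct-children e₁≢e₂ q₁ q₂

    high⇒two-children : ∀ {v} → ¬ Low T v → TwoChildren v
    high⇒two-children {v} high =
      three-edges⇒two-children (incidentEdges v) (incidentEdges-unique v) (incident-classified v) (ℕ.≰⇒> high)

    -- a deepest vertex has no children, so its only possible edge is its parent edge
    deepest⇒low : ∀ {ℓ} → (∀ w → depth w ≤ depth ℓ) → Low T ℓ
    deepest⇒low {ℓ} deepest =
      ℕ.≤-trans (unique-constant-length (incidentEdges-unique ℓ) (All.map only-parent (incident-classified ℓ))) (s≤s z≤n)
      where
      only-parent : ∀ {e} → IncidentAt ℓ e → e ≡ parentEdge ℓ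
      only-parent (inj₁ e≡) = e≡
      only-parent (inj₂ (x , x-child , _)) =
        ⊥-elim (ℕ.<⇒≱ (subst (depth ℓ <_) (sym (depth-child x-child)) ℕ.≤-refl) (deepest x))

  -- Every tree has a vertex of degree at most 2, e.g. a deepest vertex for any root.
  low-vertex : ∀ {n} (T : Graph n) → IsTree T → Σ (Fin n) (Low T)
  low-vertex {suc n} T isTree with maximiser {P = λ _ → ⊤} (λ _ → yes tt) depth {Fin.zero} tt
    where open Rooted T isTree Fin.zero using (depth)
  ... | deepest , _ , maximal = deepest , Rooted.deepest⇒low T isTree Fin.zero (λ w → maximal w tt)

module TreeCut where

  open import Defs
  open ListCounting
  open RootedTrees
  open RationalBounds using (counting-to-bound)
  open import Data.Integer using () renaming (+_ to +ℤ_)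
  open import Data.Rational as ℚ using (1ℚ; _/_)
  open import Data.Nat as ℕ using (ℕ; zero; suc; s≤s; _+_; _≤_; _<_; _∸_)
  import Data.Nat.Properties as ℕ
  open import Data.Fin using (Fin)
  open import Data.Fin.Properties using (_≟_; any?)
  open import Data.List using (List; []; _∷_; length; filter; map; _++_; allFin)
  import Data.List.Properties as List
  open import Data.List.Membership.Propositional using (_∈_)
  open import Data.List.Membership.Propositional.Properties using (∈-filter⁻; ∈-filter⁺; ∈-allFin; ∈-++⁻; ∈-++⁺ˡ; ∈-++⁺ʳ; ∈-map⁺; ∈-map⁻)
  open import Data.List.Relation.Unary.All as All using (All; []; _∷_)
  open import Data.List.Relation.Unary.Unique.Propositional using (Unique; []; _∷_)
  import Data.List.Relation.Unary.Unique.Propositional.Properties as Unique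
  open import Data.List.Relation.Unary.All.Properties using (all-filter)
  open import Data.List.Relation.Unary.AllPairs as AllPairs using (AllPairs)
  open import Data.Product using (Σ; _×_; _,_; proj₁; proj₂)
  open import Data.Sum as Sum using (_⊎_; inj₁; inj₂)
  open import Data.Empty using (⊥-elim)
  open import Function using (_∘_)
  open import Relation.Nullary using (¬_; Dec; yes; no; ¬?)
  open import Relation.Nullary.Decidable using (_⊎-dec_; _×-dec_)
  open import Relation.Binary.PropositionalEquality

  module Cut {n : ℕ} (T : Graph n) (isTree : IsTree T) (r : Fin n) (r-low : Low T r)
             (E₀ E₁ E₂ : EdgeSubset T)
             (E₀-ends : All (λ e → lowEnds T e ≡ 0) (list E₀))
             (E₁-ends : All (λ e → lowEnds T e ≡ 1) (list E₁))
             (E₂-ends : All (λ e → lowEnds T e ≡ 2) (list E₂)) where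

    open GraphFacts T
    open Rooted T isTree r

    Removed : Edge n → Set
    Removed e = e ∈ list E₀ ⊎ e ∈ list E₁ ⊎ e ∈ list E₂

    removed? : ∀ e → Dec (Removed e)
    removed? e = (e ∈? list E₀) ⊎-dec ((e ∈? list E₁) ⊎-dec (e ∈? list E₂))

    removed-∈ : ∀ {e} → Removed e → e ∈ edges T
    removed-∈ (inj₁ e∈E₀)        = All.lookup (sub E₀) e∈E₀
    removed-∈ (inj₂ (inj₁ e∈E₁)) = All.lookup (sub E₁) e∈E₁
    removed-∈ (inj₂ (inj₂ e∈E₂)) = All.lookup (sub E₂) e∈E₂

    Kept : Fin n → Fin n → Set
    Kept = AdjMinus T E₀ E₁ E₂

    -- The head of a component is its vertex closest to r: the root, or a vertex whose
    -- parent edge is removed.  head v climbs from v along kept parent edges.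
    IsHead : Fin n → Set
    IsHead v = v ≡ r ⊎ Removed (parentEdge v)

    isHead? : ∀ v → Dec (IsHead v)
    isHead? v = (v ≟ r) ⊎-dec removed? (parentEdge v)

    -- climbing with a bound on the number of steps; depth v steps always suffice
    climbKept : ℕ → Fin n → Fin n
    climbKept zero    v = v
    climbKept (suc k) v with isHead? v
    ... | yes _ = v
    ... | no _  = climbKept k (parent v)

    head : Fin n → Fin n
    head v = climbKept (depth v) v

    head-of-head : ∀ {v} → IsHead v → head v ≡ v
    head-of-head {v} v-head = fixed (depth v)
      where
      fixed : ∀ k → climbKept k v ≡ v
      fixed zero    = refl
      fixed (suc k) with isHead? v
      ... | yes _      = refl
      ... | no ¬v-head = ⊥-elim (¬v-head v-head)

    head-of-parent : ∀ {v} → ¬ IsHead v → head v ≡ head (parent v)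
    head-of-parent {v} ¬v-head = trans (cong (λ k → climbKept k v) (depth-parent (¬v-head ∘ inj₁))) unfold
      where
      unfold : climbKept (suc (depth (parent v))) v ≡ head (parent v)
      unfold with isHead? v
      ... | yes v-head = ⊥-elim (¬v-head v-head)
      ... | no _       = refl

    unremoved⇒same-head : ∀ {a b} → Adj T a b → ¬ Removed (edgeBetween a b) → head a ≡ head b
    unremoved⇒same-head ab kept-ab with adjacent⇒parent-child ab
    ... | inj₁ (a≢r , pa≡b) = trans (head-of-parent Sum.[ a≢r , kept-ab ∘ subst Removed a-edge ]′) (cong head pa≡b)
      where
      a-edge : parentEdge _ ≡ edgeBetween _ _
      a-edge = cong (edgeBetween _) pa≡b
    ... | inj₂ (b≢r , pb≡a) = sym (trans (head-of-parent Sum.[ b≢r , kept-ab ∘ subst Removed b-edge ]′) (cong head pb≡a))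
      where
      b-edge : parentEdge _ ≡ edgeBetween _ _
      b-edge = trans (cong (edgeBetween _) pb≡a) (edgeBetween-sym (adj-sym ab))

    kept⇒same-head : ∀ {a b} → Kept a b → head a ≡ head b
    kept⇒same-head (inj₁ (ab∈T , ∉E₀ , ∉E₁ , ∉E₂)) =
      unremoved⇒same-head (inj₁ ab∈T) (Sum.[ ∉E₀ , Sum.[ ∉E₁ , ∉E₂ ]′ ]′ ∘ subst Removed (sym (edge-is-edgeBetween ab∈T (inj₁ refl))))
    kept⇒same-head (inj₂ (ba∈T , ∉E₀ , ∉E₁ , ∉E₂)) =
      unremoved⇒same-head (inj₂ ba∈T) (Sum.[ ∉E₀ , Sum.[ ∉E₁ , ∉E₂ ]′ ]′ ∘ subst Removed (sym (edge-is-edgeBetween ba∈T (inj₂ refl))))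

    connected⇒same-head : ∀ {a b} → Reach Kept a b → head a ≡ head b
    connected⇒same-head here          = refl
    connected⇒same-head (step ab rest) = trans (kept⇒same-head ab) (connected⇒same-head rest)

    removedList : List (Edge n)
    removedList = list E₀ ++ list E₁ ++ list E₂

    -- the three classes are disjoint, since their edges have different numbers of low ends
    removedList-unique : Unique removedList
    removedList-unique = Unique.++⁺ (nodup E₀) (Unique.++⁺ (nodup E₁) (nodup E₂) E₁∩E₂) E₀∩E₁E₂
      where
      E₁∩E₂ : ∀ {e} → ¬ (e ∈ list E₁ × e ∈ list E₂)
      E₁∩E₂ (e∈E₁ , e∈E₂) with trans (sym (All.lookup E₁-ends e∈E₁)) (All.lookup E₂-ends e∈E₂)
      ... | ()
      E₀∩E₁E₂ : ∀ {e} → ¬ (e ∈ list E₀ × e ∈ list E₁ ++ list E₂)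
      E₀∩E₁E₂ (e∈E₀ , e∈E₁E₂) with ∈-++⁻ (list E₁) e∈E₁E₂
      ... | inj₁ e∈E₁ with trans (sym (All.lookup E₀-ends e∈E₀)) (All.lookup E₁-ends e∈E₁)
      ...   | ()
      E₀∩E₁E₂ (e∈E₀ , e∈E₁E₂) | inj₂ e∈E₂ with trans (sym (All.lookup E₀-ends e∈E₀)) (All.lookup E₂-ends e∈E₂)
      ...   | ()

    removedList-removed : ∀ {e} → e ∈ removedList → Removed e
    removedList-removed e∈ with ∈-++⁻ (list E₀) e∈
    ... | inj₁ e∈E₀ = inj₁ e∈E₀
    ... | inj₂ e∈E₁E₂ = inj₂ (∈-++⁻ (list E₁) e∈E₁E₂)

    heads : List (Fin n)
    heads = filter isHead? (allFin n)

    heads-unique : Unique heads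
    heads-unique = Unique.filter⁺ isHead? (Unique.allFin⁺ n)

    many-heads : suc (length removedList) ≤ length heads
    many-heads = subst (_≤ length heads) (cong suc (List.length-map lowerEnd removedList))
                   (unique-⊆-length candidates-unique candidates-heads)
      where
      candidates : List (Fin n)
      candidates = r ∷ map lowerEnd removedList
      lowerEnd-removed : ∀ {e} → e ∈ removedList → ¬ lowerEnd e ≡ r × parentEdge (lowerEnd e) ≡ e
      lowerEnd-removed e∈ = lowerEnd-spec (removed-∈ (removedList-removed e∈))
      candidates-unique : Unique candidates
      candidates-unique = All.tabulate r-fresh ∷ map-unique-on lowerEnd removedList-unique
        (λ e∈ e′∈ → lowerEnd-injective (removed-∈ (removedList-removed e∈)) (removed-∈ (removedList-removed e′∈)))
        where
        r-fresh : ∀ {x} → x ∈ map lowerEnd removedList → ¬ r ≡ x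
        r-fresh x∈ r≡x with ∈-map⁻ lowerEnd x∈
        ... | e , e∈ , refl = proj₁ (lowerEnd-removed e∈) (sym r≡x)
      candidates-heads : All (_∈ heads) candidates
      candidates-heads = ∈-filter⁺ isHead? (∈-allFin r) (inj₁ refl) ∷ All.tabulate lower-head
        where
        lower-head : ∀ {x} → x ∈ map lowerEnd removedList → x ∈ heads
        lower-head x∈ with ∈-map⁻ lowerEnd x∈
        ... | e , e∈ , refl = ∈-filter⁺ isHead? (∈-allFin _)
                                (inj₂ (subst Removed (sym (proj₂ (lowerEnd-removed e∈))) (removedList-removed e∈)))

    LowHead : Fin n → Set
    LowHead t = Σ (Fin n) λ v → Low T v × head v ≡ t

    lowHead? : ∀ t → Dec (LowHead t)
    lowHead? t = any? (λ v → (deg T v ℕ.≤? 2) ×-dec (head v ≟ t))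

    lowHeads highHeads : List (Fin n)
    lowHeads  = filter lowHead? heads
    highHeads = filter (¬? ∘ lowHead?) heads

    representatives : (ts : List (Fin n)) → All LowHead ts → List (Fin n)
    representatives []       []                  = []
    representatives (_ ∷ ts) ((v , _) ∷ witnesses) = v ∷ representatives ts witnesses

    representatives-length : ∀ ts ws → length (representatives ts ws) ≡ length ts
    representatives-length []       []       = refl
    representatives-length (_ ∷ ts) (_ ∷ ws) = cong suc (representatives-length ts ws)

    representatives-low : ∀ ts ws → All (Low T) (representatives ts ws)
    representatives-low []       []                    = []
    representatives-low (_ ∷ ts) ((_ , low , _) ∷ ws) = low ∷ representatives-low ts ws

    representatives-separated : ∀ ts ws → Unique ts → AllPairs (λ u v → ¬ Reach Kept u v) (representatives ts ws)
    representatives-separated []       []                      _            = AllPairs.[]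
    representatives-separated (t ∷ ts) ((v , _ , hv≡t) ∷ ws) (t∉ts ∷ ts!) =
      apart ts ws t∉ts AllPairs.∷ representatives-separated ts ws ts!
      where
      apart : ∀ ts ws → All (λ s → ¬ t ≡ s) ts → All (λ w → ¬ Reach Kept v w) (representatives ts ws)
      apart []       []                    []           = []
      apart (s ∷ ts) ((w , _ , hw≡s) ∷ ws) (t≢s ∷ t∉ts) =
        (λ v~w → t≢s (trans (sym hv≡t) (trans (connected⇒same-head v~w) hw≡s))) ∷ apart ts ws t∉ts

    lowHeads-low : All LowHead lowHeads
    lowHeads-low = all-filter lowHead? heads

    lowReps : List (Fin n)
    lowReps = representatives lowHeads lowHeads-low

    record HighHead (c : Fin n) : Set where
      field
        not-root : ¬ c ≡ r
        removed  : Removed (parentEdge c)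
        no-low   : ∀ v → Low T v → ¬ head v ≡ c
        is-head  : head c ≡ c

    highHeads-high : All HighHead highHeads
    highHeads-high = All.tabulate high
      where
      high : ∀ {c} → c ∈ highHeads → HighHead c
      high {c} c∈ with ∈-filter⁻ (¬? ∘ lowHead?) {xs = heads} c∈
      ... | c∈heads , ¬low with proj₂ (∈-filter⁻ isHead? {xs = allFin n} c∈heads)
      ...   | inj₁ c≡r = ⊥-elim (¬low (r , r-low , trans (head-of-head (inj₁ refl)) (sym c≡r)))
      ...   | inj₂ removed = record
        { not-root = λ c≡r → ¬low (r , r-low , trans (head-of-head (inj₁ refl)) (sym c≡r))
        ; removed = removed ; no-low = λ v low hv≡c → ¬low (v , low , hv≡c) ; is-head = head-of-head (inj₂ removed) }

    highHead-high : ∀ {c} → HighHead c → ¬ Low T c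
    highHead-high c-high c-low = HighHead.no-low c-high _ c-low (HighHead.is-head c-high)

    ancestorAt : ℕ → Fin n → Fin n
    ancestorAt j y = climb (depth y ∸ j) y

    ancestorAt-self : ∀ x → ancestorAt (depth x) x ≡ x
    ancestorAt-self x = cong (λ k → climb k x) (ℕ.n∸n≡0 (depth x))

    ancestorAt-child : ∀ {y v j} → Child y v → j ≤ depth v → ancestorAt j y ≡ ancestorAt j v
    ancestorAt-child {y} {v} {j} y-child@(_ , py≡v) j≤ = begin
      climb (depth y ∸ j) y          ≡⟨ cong (λ k → climb (k ∸ j) y) (depth-child y-child) ⟩
      climb (suc (depth v) ∸ j) y    ≡⟨ cong (λ k → climb k y) (ℕ.+-∸-assoc 1 j≤) ⟩
      climb (depth v ∸ j) (parent y) ≡⟨ cong (climb (depth v ∸ j)) py≡v ⟩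
      climb (depth v ∸ j) v          ∎
      where open ≡-Reasoning

    record Exit (c x : Fin n) : Set where
      field
        lower     : Fin n
        not-root  : ¬ lower ≡ r
        removed   : Removed (parentEdge lower)
        upper     : head (parent lower) ≡ c
        below     : ancestorAt (depth x) lower ≡ x

    Inside : Fin n → Fin n → Fin n → Set
    Inside c x v = head v ≡ c × ancestorAt (depth x) v ≡ x × depth x ≤ depth v

    inside? : ∀ c x v → Dec (Inside c x v)
    inside? c x v = (head v ≟ c) ×-dec ((ancestorAt (depth x) v ≟ x) ×-dec (depth x ℕ.≤? depth v))

    inside-child : ∀ {c x v y} → Inside c x v → Child y v → ¬ Removed (parentEdge y) → Inside c x y
    inside-child (hv≡c , anc≡x , x≤v) y-child@(y≢r , py≡v) y-kept =
      trans (head-of-parent Sum.[ y≢r , y-kept ]′) (trans (cong head py≡v) hv≡c) ,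
      trans (ancestorAt-child y-child x≤v) anc≡x ,
      ℕ.≤-trans x≤v (ℕ.≤-trans (ℕ.n≤1+n _) (ℕ.≤-reflexive (sym (depth-child y-child))))

    -- A deepest inside vertex v is high (it lies in c's component), so it has a child y;
    -- y is not inside, hence the edge from y to v is removed: an exit.
    exit-at-deepest : ∀ {c x} → HighHead c → ∀ v → Inside c x v → (∀ w → Inside c x w → depth w ≤ depth v) → Exit c x
    exit-at-deepest c-high v v-inside@(hv≡c , anc≡x , x≤v) deepest
      with high⇒two-children (λ low → HighHead.no-low c-high v low hv≡c)
    ... | y , _ , y-child@(y≢r , py≡v) , _ with removed? (parentEdge y)
    ...   | yes removed = record
      { lower = y ; not-root = y≢r ; removed = removed
      ; upper = trans (cong head py≡v) hv≡c ; below = trans (ancestorAt-child y-child x≤v) anc≡x }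
    ...   | no y-kept = ⊥-elim (ℕ.<⇒≱ v<y (deepest y (inside-child v-inside y-child y-kept)))
      where
      v<y : depth v < depth y
      v<y = subst (_< depth y) (cong depth py≡v) (parent-shallower y≢r)

    exit-below : ∀ {c x} → HighHead c → Child x c → Exit c x
    exit-below {c} {x} c-high (x≢r , px≡c) with removed? (parentEdge x)
    ... | yes removed = record
      { lower = x ; not-root = x≢r ; removed = removed
      ; upper = trans (cong head px≡c) (HighHead.is-head c-high) ; below = ancestorAt-self x }
    ... | no kept = exit-at-deepest c-high (proj₁ choice) (proj₁ (proj₂ choice)) (proj₂ (proj₂ choice))
      where
      x-inside : Inside c x x
      x-inside = trans (head-of-parent Sum.[ x≢r , kept ]′) (trans (cong head px≡c) (HighHead.is-head c-high)) ,
                 ancestorAt-self x , ℕ.≤-refl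
      choice : Σ (Fin n) λ v → Inside c x v × (∀ w → Inside c x w → depth w ≤ depth v)
      choice = maximiser (inside? c x) depth x-inside

    record TwoExits (c : Fin n) : Set where
      field
        {x₁ x₂}  : Fin n
        exit₁    : Exit c x₁
        exit₂    : Exit c x₂
        distinct : ¬ parentEdge (Exit.lower exit₁) ≡ parentEdge (Exit.lower exit₂)

    two-exits : ∀ {c} → HighHead c → TwoExits c
    two-exits {c} c-high with high⇒two-children (highHead-high c-high)
    ... | x₁ , x₂ , x₁-child , x₂-child , x₁≢x₂ = record
      { exit₁ = exit₁ ; exit₂ = exit₂ ; distinct = distinct }
      where
      exit₁ : Exit c x₁
      exit₁ = exit-below c-high x₁-child
      exit₂ : Exit c x₂
      exit₂ = exit-below c-high x₂-child
      -- both children sit at depth 1 + depth c, and each exit determines its ancestor there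
      distinct : ¬ parentEdge (Exit.lower exit₁) ≡ parentEdge (Exit.lower exit₂)
      distinct same = x₁≢x₂ (begin
        x₁                                          ≡⟨ Exit.below exit₁ ⟨
        ancestorAt (depth x₁) (Exit.lower exit₁)    ≡⟨ cong₂ ancestorAt same-depth same-lower ⟩
        ancestorAt (depth x₂) (Exit.lower exit₂)    ≡⟨ Exit.below exit₂ ⟩
        x₂                                          ∎)
        where
        open ≡-Reasoning
        same-lower : Exit.lower exit₁ ≡ Exit.lower exit₂
        same-lower = parentEdge-injective (Exit.not-root exit₁) (Exit.not-root exit₂) same
        same-depth : depth x₁ ≡ depth x₂
        same-depth = trans (depth-child x₁-child) (sym (depth-child x₂-child))

    -- the upper end of an exit edge is in a high component, so the edge lies in E₀ or E₁
    exit-upper-high : ∀ {c x} → HighHead c → (ex : Exit c x) → ¬ Low T (parent (Exit.lower ex))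
    exit-upper-high c-high ex low = HighHead.no-low c-high _ low (Exit.upper ex)

    lowEnds-high-upper : ∀ {y} → ¬ Low T (parent y) → lowEnds T (parentEdge y) ≤ 1
    lowEnds-high-upper {y} high = subst (_≤ 1) (sym ends) (lowInd-≤1 y)
      where
      ends : lowEnds T (parentEdge y) ≡ lowInd T y
      ends = trans (lowEnds-edgeBetween y (parent y)) (trans (cong (lowInd T y +_) (lowInd-high high)) (ℕ.+-identityʳ _))

    few-low-ends⇒E₀₁ : ∀ {e} → lowEnds T e ≤ 1 → Removed e → e ∈ list E₀ ++ list E₁
    few-low-ends⇒E₀₁ _   (inj₁ e∈E₀)        = ∈-++⁺ˡ e∈E₀
    few-low-ends⇒E₀₁ _   (inj₂ (inj₁ e∈E₁)) = ∈-++⁺ʳ (list E₀) e∈E₁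
    few-low-ends⇒E₀₁ ≤1 (inj₂ (inj₂ e∈E₂)) with subst (_≤ 1) (All.lookup E₂-ends e∈E₂) ≤1
    ... | s≤s ()

    high-upper⇒E₀₁ : ∀ {y} → ¬ Low T (parent y) → Removed (parentEdge y) → parentEdge y ∈ list E₀ ++ list E₁
    high-upper⇒E₀₁ high = few-low-ends⇒E₀₁ (lowEnds-high-upper high)

    componentAbove : Edge n → Fin n
    componentAbove g = head (parent (lowerEnd g))

    exit-above : ∀ {c x} (ex : Exit c x) → componentAbove (parentEdge (Exit.lower ex)) ≡ c
    exit-above ex = trans (cong (head ∘ parent) (lowerEnd-parentEdge (Exit.not-root ex))) (Exit.upper ex)

    -- First count: each high component owns its two exit edges, which lie in E₀ ∪ E₁.
    module ExitCharging = Charging componentAbove (list E₀ ++ list E₁) 2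

    exit-share : ∀ {c} → HighHead c → ExitCharging.Share c
    exit-share c-high = record
      { items  = parentEdge (Exit.lower exit₁) ∷ parentEdge (Exit.lower exit₂) ∷ []
      ; items! = (distinct ∷ []) ∷ [] ∷ []
      ; owned  = exit-above exit₁ ∷ exit-above exit₂ ∷ []
      ; inPool = high-upper⇒E₀₁ (exit-upper-high c-high exit₁) (Exit.removed exit₁)
               ∷ high-upper⇒E₀₁ (exit-upper-high c-high exit₂) (Exit.removed exit₂) ∷ []
      ; enough = ℕ.≤-refl }
      where open TwoExits (two-exits c-high)

    highHeads-unique : Unique highHeads
    highHeads-unique = Unique.filter⁺ (¬? ∘ lowHead?) heads-unique

    two-per-high : 2 ℕ.* length highHeads ≤ length (list E₀ ++ list E₁)
    two-per-high = ExitCharging.charging-bound highHeads (All.map exit-share highHeads-high) highHeads-unique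

    -- Second count: every edge of E₀ ∪ E₁ carries a primary charge and every edge of E₀
    -- also a secondary one.  A high component owns the primary charges of its two exits and
    -- one charge of its own parent edge, which is in E₀ (secondary charge) or in E₁ with a
    -- low upper end (primary charge, owned by the component below).
    data Charge : Set where
      primary secondary : Edge n → Charge

    primary-injective : ∀ {g g′} → primary g ≡ primary g′ → g ≡ g′
    primary-injective refl = refl

    chargePool : List Charge
    chargePool = map primary (list E₀ ++ list E₁) ++ map secondary (list E₀)

    chargeOwner : Charge → Fin n
    chargeOwner (secondary g) = lowerEnd g
    chargeOwner (primary g) with deg T (parent (lowerEnd g)) ℕ.≤? 2
    ... | yes _ = lowerEnd g
    ... | no _  = componentAbove g

    exit-charge-owner : ∀ {c x} → HighHead c → (ex : Exit c x) → chargeOwner (primary (parentEdge (Exit.lower ex))) ≡ c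
    exit-charge-owner c-high ex with deg T (parent (lowerEnd (parentEdge (Exit.lower ex)))) ℕ.≤? 2
    ... | yes low = ⊥-elim (exit-upper-high c-high ex
                      (subst (Low T ∘ parent) (lowerEnd-parentEdge (Exit.not-root ex)) low))
    ... | no _    = exit-above ex

    exit-charge-pool : ∀ {c x} → HighHead c → (ex : Exit c x) → primary (parentEdge (Exit.lower ex)) ∈ chargePool
    exit-charge-pool c-high ex =
      ∈-++⁺ˡ (∈-map⁺ primary (high-upper⇒E₀₁ (exit-upper-high c-high ex) (Exit.removed ex)))

    record ParentCharge (c : Fin n) : Set where
      field
        charge : Charge
        owned  : chargeOwner charge ≡ c
        inPool : charge ∈ chargePool
        fresh  : ∀ {y} → ¬ y ≡ r → ¬ Low T (parent y) → ¬ charge ≡ primary (parentEdge y)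

    parent-charge : ∀ {c} → HighHead c → ParentCharge c
    parent-charge {c} c-high with parentEdge c ∈? list E₀
    ... | yes e∈E₀ = record
      { charge = secondary (parentEdge c) ; owned = lowerEnd-parentEdge (HighHead.not-root c-high)
      ; inPool = ∈-++⁺ʳ (map primary (list E₀ ++ list E₁)) (∈-map⁺ secondary e∈E₀)
      ; fresh = λ _ _ () }
    ... | no e∉E₀ = record
      { charge = primary (parentEdge c) ; owned = owned ; inPool = ∈-++⁺ˡ (∈-map⁺ primary e∈E₀₁) ; fresh = fresh }
      where
      c≢r : ¬ c ≡ r
      c≢r = HighHead.not-root c-high
      ends : lowEnds T (parentEdge c) ≡ lowInd T (parent c)
      ends = trans (lowEnds-edgeBetween c (parent c)) (cong (_+ lowInd T (parent c)) (lowInd-high (highHead-high c-high)))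
      -- c is high, so its parent edge has at most one low end: it is in E₁, and then parent c is low
      e∈E₀₁ : parentEdge c ∈ list E₀ ++ list E₁
      e∈E₀₁ = few-low-ends⇒E₀₁ (subst (_≤ 1) (sym ends) (lowInd-≤1 (parent c))) (HighHead.removed c-high)
      e∈E₁ : parentEdge c ∈ list E₁
      e∈E₁ with ∈-++⁻ (list E₀) e∈E₀₁
      ... | inj₁ e∈E₀ = ⊥-elim (e∉E₀ e∈E₀)
      ... | inj₂ e∈E₁ = e∈E₁
      parent-low : Low T (parent c)
      parent-low = lowInd-one (trans (sym ends) (All.lookup E₁-ends e∈E₁))
      owned : chargeOwner (primary (parentEdge c)) ≡ c
      owned with deg T (parent (lowerEnd (parentEdge c))) ℕ.≤? 2
      ... | yes _   = lowerEnd-parentEdge c≢r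
      ... | no high = ⊥-elim (high (subst (Low T ∘ parent) (sym (lowerEnd-parentEdge c≢r)) parent-low))
      fresh : ∀ {y} → ¬ y ≡ r → ¬ Low T (parent y) → ¬ primary (parentEdge c) ≡ primary (parentEdge y)
      fresh y≢r high same = high (subst (Low T ∘ parent) (parentEdge-injective c≢r y≢r (primary-injective same)) parent-low)

    module ParentCharging = Charging chargeOwner chargePool 3

    charge-share : ∀ {c} → HighHead c → ParentCharging.Share c
    charge-share c-high = record
      { items  = primary g₁ ∷ primary g₂ ∷ charge ∷ []
      ; items! = (distinct ∘ primary-injective ∷ fresh₁ ∘ sym ∷ []) ∷ (fresh₂ ∘ sym ∷ []) ∷ [] ∷ []
      ; owned  = exit-charge-owner c-high exit₁ ∷ exit-charge-owner c-high exit₂ ∷ owned ∷ []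
      ; inPool = exit-charge-pool c-high exit₁ ∷ exit-charge-pool c-high exit₂ ∷ inPool ∷ []
      ; enough = ℕ.≤-refl }
      where
      open TwoExits (two-exits c-high)
      open ParentCharge (parent-charge c-high)
      g₁ g₂ : Edge n
      g₁ = parentEdge (Exit.lower exit₁)
      g₂ = parentEdge (Exit.lower exit₂)
      fresh₁ : ¬ charge ≡ primary g₁
      fresh₁ = fresh (Exit.not-root exit₁) (exit-upper-high c-high exit₁)
      fresh₂ : ¬ charge ≡ primary g₂
      fresh₂ = fresh (Exit.not-root exit₂) (exit-upper-high c-high exit₂)

    three-per-high : 3 ℕ.* length highHeads ≤ length chargePool
    three-per-high = ParentCharging.charging-bound highHeads (All.map charge-share highHeads-high) highHeads-unique

    e₀ e₁ e₂ h : ℕ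
    e₀ = length (list E₀)
    e₁ = length (list E₁)
    e₂ = length (list E₂)
    h  = length highHeads

    components-bound : suc (e₀ + e₁ + e₂) ≤ length lowReps + h
    components-bound = subst₂ _≤_ (cong suc removed-count) head-count many-heads
      where
      removed-count : length removedList ≡ e₀ + e₁ + e₂
      removed-count = trans (List.length-++ (list E₀))
                        (trans (cong (e₀ +_) (List.length-++ (list E₁))) (sym (ℕ.+-assoc e₀ e₁ e₂)))
      head-count : length heads ≡ length lowReps + h
      head-count = trans (sym (filter-complement-length lowHead? heads))
                     (cong (_+ h) (sym (representatives-length lowHeads lowHeads-low)))

    exits-bound : h + h ≤ e₀ + e₁
    exits-bound = subst₂ _≤_ (cong (h +_) (ℕ.+-identityʳ h)) (List.length-++ (list E₀)) two-per-high

    charges-bound : h + h + h ≤ e₀ + e₀ + e₁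
    charges-bound = subst₂ _≤_ (trans (cong (λ m → h + (h + m)) (ℕ.+-identityʳ h)) (sym (ℕ.+-assoc h h h)))
                      pool-size three-per-high
      where
      open ≡-Reasoning
      pool-size : length chargePool ≡ e₀ + e₀ + e₁
      pool-size = begin
        length chargePool                                                   ≡⟨ List.length-++ (map primary (list E₀ ++ list E₁)) ⟩
        length (map primary (list E₀ ++ list E₁)) + length (map secondary (list E₀))
          ≡⟨ cong₂ _+_ (List.length-map primary (list E₀ ++ list E₁)) (List.length-map secondary (list E₀)) ⟩
        length (list E₀ ++ list E₁) + e₀                                    ≡⟨ cong (_+ e₀) (List.length-++ (list E₀)) ⟩
        e₀ + e₁ + e₀                                                        ≡⟨ ℕ.+-comm (e₀ + e₁) e₀ ⟩
        e₀ + (e₀ + e₁)                                                      ≡⟨ ℕ.+-assoc e₀ e₀ e₁ ⟨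
        e₀ + e₀ + e₁                                                        ∎

    low-components : ∀ k → +ℤ 1 / 3 ℚ.≤ k → k ℚ.≤ +ℤ 1 / 2 →
      AtLeastLowComponents T Kept (1ℚ ℚ.+ k ℚ.* ℕtoℚ e₀ ℚ.+ (1ℚ ℚ.- k) ℚ.* ℕtoℚ e₁ ℚ.+ ℕtoℚ e₂)
    low-components k k≥⅓ k≤½ =
      lowReps ,
      representatives-low lowHeads lowHeads-low ,
      representatives-separated lowHeads lowHeads-low (Unique.filter⁺ lowHead? heads-unique) ,
      counting-to-bound e₀ e₁ e₂ h (length lowReps) k k≥⅓ k≤½ components-bound exits-bound charges-bound

open import Defs
open import Data.Nat using (ℕ)
open import Data.List using (length)
open import Data.List.Relation.Unary.All using (All)
open import Data.Product using (_,_)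
open import Relation.Binary.PropositionalEquality using (_≡_)
open import Data.Integer using (+_)
open import Data.Rational using (ℚ; _≤_; _+_; _*_; _-_; _/_; 1ℚ)
open RootedTrees using (low-vertex)
open TreeCut using (module Cut)

lemma4p2 : ∀ {n} (T : Graph n) → IsTree T →
  (E₀ E₁ E₂ : EdgeSubset T) →
  All (λ e → lowEnds T e ≡ 0) (list E₀) →
  All (λ e → lowEnds T e ≡ 1) (list E₁) →
  All (λ e → lowEnds T e ≡ 2) (list E₂) →
  (k : ℚ) → (+ 1 / 3) ≤ k → k ≤ (+ 1 / 2) →
  AtLeastLowComponents T (AdjMinus T E₀ E₁ E₂)
    (1ℚ + k * ℕtoℚ (length (list E₀)) + (1ℚ - k) * ℕtoℚ (length (list E₁)) + ℕtoℚ (length (list E₂)))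
lemma4p2 T isTree E₀ E₁ E₂ E₀-ends E₁-ends E₂-ends k k≥⅓ k≤½ with low-vertex T isTree
... | r , r-low = Cut.low-components T isTree r r-low E₀ E₁ E₂ E₀-ends E₁-ends E₂-ends k k≥⅓ k≤½
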